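{- Let $q=p^\ell$, let $f_1,f_2\in\mathbb{F}_q[X,Y]$ with $f_1(0,0)=f_2(0,0)=0$, and let $\mathcal{S}_{f_1,f_2}\subset\mathrm{PG}(4,q)$ be the hypersurface $F(X_0,X_1,X_2,X_3,X_4)=0$ defined below. Then $\mathcal{O}_5(f_1,f_2)$ is an ovoid of $Q^+(5,q)$ if and only if $\mathcal{S}_{f_1,f_2}$ has no affine $\mathbb{F}_q$-rational point (i.e. point $(1,x_1,y_1,x_2,y_2)$ with $x_1,y_1,x_2,y_2\in\mathbb{F}_q$) outside the subspace $X_1-X_3=0=X_2-X_4$.
   Context: $Q^+(5,q)$ is the quadric $X_0X_5+X_1X_4+X_2X_3=0$ of $\mathrm{PG}(5,q)$; a generator is a plane contained in it, and an ovoid is a set of its points meeting every generator in exactly one point. $\mathcal{O}_5(f_1,f_2)=\{(1,x,y,f_1(x,y),f_2(x,y),-xf_2(x,y)-yf_1(x,y)) : x,y\in\mathbb{F}_q\}\cup\{(0,0,0,0,0,1)\}$. Write $f_1=\sum a_{i,j}X^iY^j$, $f_2=\sum b_{i,j}X^iY^j$, $d=\max\{\deg f_1,\deg f_2\}$, and $F=(X_2-X_4)\sum_{i,j}a_{i,j}(X_3^iX_4^j-X_1^iX_2^j)X_0^{d-i-j}+(X_1-X_3)\sum_{i,j}b_{i,j}(X_3^iX_4^j-X_1^iX_2^j)X_0^{d-i-j}$. -}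

module Defs where

open import Level using (Level)
open import Algebra.Bundles using (CommutativeRing)
open import Data.Nat as ℕ using (ℕ; _∸_)
open import Data.Fin using (Fin; zero; suc)
open import Data.List using (List; []; _∷_; foldr)
open import Data.List.Relation.Unary.Any using (Any)
open import Data.Maybe using (Maybe; just; nothing)
open import Data.Product using (Σ; ∃; _×_; _,_)
open import Relation.Nullary using (¬_)
open import Relation.Binary.Definitions using (Decidable)

record FiniteField (c ℓ : Level) : Set (Level.suc (c Level.⊔ ℓ)) where
  field
    commRing  : CommutativeRing c ℓ
  open CommutativeRing commRing public
  field
    0≉1       : ¬ (0# ≈ 1#)
    inverse   : ∀ x → ¬ (x ≈ 0#) → ∃ λ y → x * y ≈ 1#
    _≟_       : Decidable _≈_
    elements  : List Carrier
    complete  : ∀ x → Any (x ≈_) elements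

module _ {c ℓ} (𝔽 : FiniteField c ℓ) where
  open FiniteField 𝔽 hiding (zero)

  _^_ : Carrier → ℕ → Carrier
  x ^ ℕ.zero  = 1#
  x ^ ℕ.suc n = x * (x ^ n)

  -- Bivariate polynomials over 𝔽: a finite list of terms  a X^i Y^j,
  -- represented as (a , i , j); the polynomial is their sum.

  Term : Set c
  Term = Carrier × ℕ × ℕ

  Poly : Set c
  Poly = List Term

  eval : Poly → Carrier → Carrier → Carrier
  eval f x y = foldr (λ { (a , i , j) s → a * (x ^ i) * (y ^ j) + s }) 0# f

  deg : Poly → ℕ
  deg = foldr (λ { (a , i , j) d → (i ℕ.+ j) ℕ.⊔ d }) 0

  homSum : ℕ → Poly → (x0 x1 x2 x3 x4 : Carrier) → Carrier
  homSum d f x0 x1 x2 x3 x4 =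
    foldr (λ { (a , i , j) s →
                 a * ((x3 ^ i) * (x4 ^ j) - (x1 ^ i) * (x2 ^ j)) * (x0 ^ (d ∸ (i ℕ.+ j))) + s })
          0# f

  polyF : (f₁ f₂ : Poly) → (x0 x1 x2 x3 x4 : Carrier) → Carrier
  polyF f₁ f₂ x0 x1 x2 x3 x4 =
    (x2 - x4) * homSum d f₁ x0 x1 x2 x3 x4 + (x1 - x3) * homSum d f₂ x0 x1 x2 x3 x4
    where d = deg f₁ ℕ.⊔ deg f₂

  NoAffinePointOutside : (f₁ f₂ : Poly) → Set (c Level.⊔ ℓ)
  NoAffinePointOutside f₁ f₂ =
    ¬ (Σ Carrier λ x₁ → Σ Carrier λ y₁ → Σ Carrier λ x₂ → Σ Carrier λ y₂ →
         (polyF f₁ f₂ 1# x₁ y₁ x₂ y₂ ≈ 0#)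
       × ¬ ((x₁ - x₂ ≈ 0#) × (y₁ - y₂ ≈ 0#)))

  V6 : Set c
  V6 = Fin 6 → Carrier

  infix 4 _≈ᵥ_
  infixl 6 _⊕_
  infixr 7 _·_

  _≈ᵥ_ : V6 → V6 → Set ℓ
  u ≈ᵥ v = ∀ k → u k ≈ v k

  NonZero : V6 → Set ℓ
  NonZero v = ¬ (∀ k → v k ≈ 0#)

  _·_ : Carrier → V6 → V6
  (a · v) k = a * v k

  _⊕_ : V6 → V6 → V6
  (u ⊕ v) k = u k + v k

  vec6 : (a b c d e f : Carrier) → V6
  vec6 a b c d e f zero = a
  vec6 a b c d e f (suc zero) = b
  vec6 a b c d e f (suc (suc zero)) = c
  vec6 a b c d e f (suc (suc (suc zero))) = d
  vec6 a b c d e f (suc (suc (suc (suc zero)))) = e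
  vec6 a b c d e f (suc (suc (suc (suc (suc zero))))) = f

  Qform : V6 → Carrier
  Qform v = v zero * v (suc (suc (suc (suc (suc zero)))))
          + v (suc zero) * v (suc (suc (suc (suc zero))))
          + v (suc (suc zero)) * v (suc (suc (suc zero)))

  SamePoint : V6 → V6 → Set (c Level.⊔ ℓ)
  SamePoint u v = Σ Carrier λ λ' → v ≈ᵥ (λ' · u)

  record Generator : Set (c Level.⊔ ℓ) where
    field
      u v w       : V6
      independent : ∀ a b c' → ((a · u) ⊕ (b · v)) ⊕ (c' · w) ≈ᵥ (λ _ → 0#)
                    → (a ≈ 0#) × (b ≈ 0#) × (c' ≈ 0#)
      singular    : ∀ a b c' → Qform (((a · u) ⊕ (b · v)) ⊕ (c' · w)) ≈ 0#

  InPlane : Generator → V6 → Set (c Level.⊔ ℓ)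
  InPlane π x = Σ Carrier λ a → Σ Carrier λ b → Σ Carrier λ c' →
                  x ≈ᵥ (((a · u) ⊕ (b · v)) ⊕ (c' · w))
    where open Generator π

  -- A set of points of PG(5,q), given as a predicate on (nonzero)
  -- vectors; an ovoid of Q⁺(5,q) is a set of points of the quadric
  -- meeting every generator in exactly one point.
  IsOvoid : (V6 → Set (c Level.⊔ ℓ)) → Set (c Level.⊔ ℓ)
  IsOvoid S =
      (∀ x → NonZero x → S x → Qform x ≈ 0#)
    × (∀ (π : Generator) →
         (Σ V6 λ x → NonZero x × InPlane π x × S x)
       × (∀ x y → NonZero x → NonZero y → InPlane π x → InPlane π y
                → S x → S y → SamePoint x y))

  rep : (f₁ f₂ : Poly) → Maybe (Carrier × Carrier) → V6
  rep f₁ f₂ (just (x , y)) =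
    vec6 1# x y (eval f₁ x y) (eval f₂ x y) (- (x * eval f₂ x y) - y * eval f₁ x y)
  rep f₁ f₂ nothing = vec6 0# 0# 0# 0# 0# 1#

  O₅ : (f₁ f₂ : Poly) → V6 → Set (c Level.⊔ ℓ)
  O₅ f₁ f₂ x = Σ (Maybe (Carrier × Carrier)) λ i → SamePoint (rep f₁ f₂ i) x

module Submission where

-- The polar form of Q⁺(5,q) at the points P(x₁,y₁), P(x₂,y₂) of O₅(f₁,f₂) with
-- first coordinate 1 is F(1,x₁,y₁,x₂,y₂), and at P(x,y) and e₅ = (0,0,0,0,0,1)
-- it is 1. Points of a generator are pairwise orthogonal, so when S has no
-- affine point off X₁ = X₃, X₂ = X₄ a generator contains at most one point of
-- O₅. It contains at least one by counting: if e₅ is not on the generator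
-- ⟨u,v,w⟩, then (x,y,a,b,c) ↦ the first five coordinates of P(x,y) − au − bv − cw
-- is an injective self-map of 𝔽⁵ (injectivity uses the absence of affine
-- points once more), hence surjective, and a zero of it gives au + bv + cw =
-- P(x,y), the last coordinate being forced by singularity. Conversely, two distinct orthogonal points of O₅ together with a
-- suitable singular vector (0,α,β,γ,δ,∗) orthogonal to both span a generator
-- meeting O₅ twice.

open import Algebra.Bundles using (CommutativeRing)
open import Data.Bool using (Bool; true; false)
open import Data.Fin using (Fin; zero; suc; #_; inject₁; fromℕ)
open import Data.Fin.Relation.Unary.Top using (view; ‵fromℕ; ‵inject₁)
open import Data.Fin.Properties using (injective⇒≤; all?)
open import Data.Integer as ℤ using (ℤ; +_; -[1+_]; _⊖_; sign; ∣_∣)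
import Data.Integer.Properties as ℤ
open import Data.List using (List; []; _∷_; length; lookup; deduplicate; cartesianProduct)
open import Data.List.Membership.Propositional.Properties using (∈-lookup)
import Data.List.Relation.Unary.All as All
open import Data.List.Relation.Unary.AllPairs using (_∷_)
open import Data.List.Relation.Unary.Any as Any using (index; any?)
open import Data.List.Relation.Unary.Any.Properties using (lookup-index)
open import Data.List.Relation.Unary.Enumerates.Setoid using (IsEnumeration)
open import Data.List.Relation.Unary.Enumerates.Setoid.Properties using (deduplicate⁺; cartesianProduct⁺)
open import Data.List.Relation.Unary.Unique.DecSetoid.Properties using (deduplicate-!)
import Data.List.Relation.Unary.Unique.Setoid as UniqueSetoid
open import Data.Maybe using (just; nothing)
open import Function using (_∘_)
import Data.Nat as ℕ
open import Data.Nat using (_∸_)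
open import Data.Nat.Properties using (1+n≰n)
open import Data.Product using (Σ; ∃; _×_; _,_; proj₁; proj₂)
open import Data.Product.Relation.Binary.Pointwise.NonDependent using (×-decSetoid)
open import Data.Sign as Sign using (Sign)
open import Function.Bundles using (_⇔_; mk⇔)
open import Function.Definitions using (Congruent; Injective; StrictlySurjective)
open import Relation.Binary.Bundles using (DecSetoid)
open import Relation.Binary.Core using (Rel)
open import Relation.Binary.Definitions using (_Respects_)
open import Relation.Binary.PropositionalEquality as ≡ using (_≡_)
open import Relation.Nullary using (¬_; Dec; yes; no; contradiction)
import Relation.Nullary.Decidable as Dec
open import Relation.Nullary.Decidable using (decidable-stable)

open import Defs

-- The ring solver needs coefficients with a computable zero test; ℤ, mapped
-- into R by n ↦ n · 1, provides them for an arbitrary commutative ring.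
module ℤCoefficientSolver {c ℓ} (R : CommutativeRing c ℓ) where
  open CommutativeRing R
  open import Algebra.Properties.Ring ring
    using (-0#≈0#; -‿involutive; -‿distribˡ-*; -‿distribʳ-*; -‿+-comm)
  open import Algebra.Properties.Semiring.Mult.TCOptimised semiring
    using (×-homo-+; ×1-homo-*; 1+×) renaming (_×_ to _×′_)
  open import Algebra.Properties.Semiring.Exp.TCOptimised semiring using (^-congˡ)
  open import Relation.Binary.Reasoning.Setoid setoid
  open import Tactic.RingSolver.Core.AlmostCommutativeRing using (fromCommutativeRing)
  open import Tactic.RingSolver.Core.Polynomial.Parameters using (Homomorphism)
  open import Data.Vec using (Vec)

  ⟦_⟧ℤ : ℤ → Carrier
  ⟦ + n ⟧ℤ      = n ×′ 1#
  ⟦ -[1+ n ] ⟧ℤ = - (ℕ.suc n ×′ 1#)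

  signed : Sign → Carrier → Carrier
  signed Sign.+ x = x
  signed Sign.- x = - x

  signed-cong : ∀ s {x y} → x ≈ y → signed s x ≈ signed s y
  signed-cong Sign.+ x≈y = x≈y
  signed-cong Sign.- x≈y = -‿cong x≈y

  signed-* : ∀ s t x y → signed (s Sign.* t) (x * y) ≈ signed s x * signed t y
  signed-* Sign.+ Sign.+ x y = refl
  signed-* Sign.+ Sign.- x y = -‿distribʳ-* x y
  signed-* Sign.- Sign.+ x y = -‿distribˡ-* x y
  signed-* Sign.- Sign.- x y = begin
    x * y           ≈⟨ -‿involutive (x * y) ⟨
    - (- (x * y))   ≈⟨ -‿cong (-‿distribʳ-* x y) ⟩
    - (x * - y)     ≈⟨ -‿distribˡ-* x (- y) ⟩
    - x * - y       ∎

  ⟦◃⟧ : ∀ s n → ⟦ s ℤ.◃ n ⟧ℤ ≈ signed s (n ×′ 1#)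
  ⟦◃⟧ Sign.+ ℕ.zero    = refl
  ⟦◃⟧ Sign.- ℕ.zero    = sym -0#≈0#
  ⟦◃⟧ Sign.+ (ℕ.suc n) = refl
  ⟦◃⟧ Sign.- (ℕ.suc n) = refl

  ⟦sign◃∣∣⟧ : ∀ i → ⟦ i ⟧ℤ ≈ signed (sign i) (∣ i ∣ ×′ 1#)
  ⟦sign◃∣∣⟧ (+ ℕ.zero)  = refl
  ⟦sign◃∣∣⟧ (+ ℕ.suc n) = refl
  ⟦sign◃∣∣⟧ -[1+ n ]    = refl

  ⟦⊖⟧ : ∀ m n → ⟦ m ⊖ n ⟧ℤ ≈ m ×′ 1# - n ×′ 1#
  ⟦⊖⟧ ℕ.zero    ℕ.zero    = sym (-‿inverseʳ 0#)
  ⟦⊖⟧ (ℕ.suc m) ℕ.zero    = sym (trans (+-congˡ -0#≈0#) (+-identityʳ _))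
  ⟦⊖⟧ ℕ.zero    (ℕ.suc n) = sym (+-identityˡ _)
  ⟦⊖⟧ (ℕ.suc m) (ℕ.suc n) = begin
    ⟦ ℕ.suc m ⊖ ℕ.suc n ⟧ℤ          ≡⟨ ≡.cong ⟦_⟧ℤ (ℤ.[1+m]⊖[1+n]≡m⊖n m n) ⟩
    ⟦ m ⊖ n ⟧ℤ                      ≈⟨ ⟦⊖⟧ m n ⟩
    a - b                           ≈⟨ shift ⟩
    (1# + a) - (1# + b)             ≈⟨ +-cong (1+× m 1#) (-‿cong (1+× n 1#)) ⟨
    ℕ.suc m ×′ 1# - ℕ.suc n ×′ 1#   ∎
    where
    a = m ×′ 1#
    b = n ×′ 1#
    shift : a - b ≈ (1# + a) - (1# + b)
    shift = begin
      a - b                   ≈⟨ +-identityˡ _ ⟨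
      0# + (a - b)            ≈⟨ +-congʳ (-‿inverseʳ 1#) ⟨
      (1# - 1#) + (a - b)     ≈⟨ +-assoc 1# (- 1#) (a - b) ⟩
      1# + (- 1# + (a - b))   ≈⟨ +-congˡ (+-assoc (- 1#) a (- b)) ⟨
      1# + ((- 1# + a) - b)   ≈⟨ +-congˡ (+-congʳ (+-comm (- 1#) a)) ⟩
      1# + ((a - 1#) - b)     ≈⟨ +-congˡ (+-assoc a (- 1#) (- b)) ⟩
      1# + (a + (- 1# - b))   ≈⟨ +-assoc 1# a _ ⟨
      (1# + a) + (- 1# - b)   ≈⟨ +-congˡ (-‿+-comm 1# b) ⟩
      (1# + a) - (1# + b)     ∎

  ⟦⟧-+ : ∀ i j → ⟦ i ℤ.+ j ⟧ℤ ≈ ⟦ i ⟧ℤ + ⟦ j ⟧ℤ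
  ⟦⟧-+ (+ m)    (+ n)    = ×-homo-+ 1# m n
  ⟦⟧-+ (+ m)    -[1+ n ] = ⟦⊖⟧ m (ℕ.suc n)
  ⟦⟧-+ -[1+ m ] (+ n)    = trans (⟦⊖⟧ n (ℕ.suc m)) (+-comm _ _)
  ⟦⟧-+ -[1+ m ] -[1+ n ] = begin
    - (ℕ.suc (ℕ.suc (m ℕ.+ n)) ×′ 1#)      ≡⟨ ≡.cong (λ k → - (ℕ.suc k ×′ 1#)) (≡.sym (ℕ+-suc m n)) ⟩
    - ((ℕ.suc m ℕ.+ ℕ.suc n) ×′ 1#)         ≈⟨ -‿cong (×-homo-+ 1# (ℕ.suc m) (ℕ.suc n)) ⟩
    - (ℕ.suc m ×′ 1# + ℕ.suc n ×′ 1#)       ≈⟨ -‿+-comm _ _ ⟨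
    - (ℕ.suc m ×′ 1#) + - (ℕ.suc n ×′ 1#)   ∎
    where open import Data.Nat.Properties using () renaming (+-suc to ℕ+-suc)

  ⟦⟧-* : ∀ i j → ⟦ i ℤ.* j ⟧ℤ ≈ ⟦ i ⟧ℤ * ⟦ j ⟧ℤ
  ⟦⟧-* i j = begin
    ⟦ i ℤ.* j ⟧ℤ                                       ≈⟨ ⟦◃⟧ (sign i Sign.* sign j) (∣ i ∣ ℕ.* ∣ j ∣) ⟩
    signed (sign i Sign.* sign j) ((∣ i ∣ ℕ.* ∣ j ∣) ×′ 1#)
      ≈⟨ signed-cong (sign i Sign.* sign j) (×1-homo-* ∣ i ∣ ∣ j ∣) ⟩
    signed (sign i Sign.* sign j) ((∣ i ∣ ×′ 1#) * (∣ j ∣ ×′ 1#))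
      ≈⟨ signed-* (sign i) (sign j) _ _ ⟩
    signed (sign i) (∣ i ∣ ×′ 1#) * signed (sign j) (∣ j ∣ ×′ 1#)
      ≈⟨ *-cong (⟦sign◃∣∣⟧ i) (⟦sign◃∣∣⟧ j) ⟨
    ⟦ i ⟧ℤ * ⟦ j ⟧ℤ                                    ∎

  ⟦⟧-neg : ∀ i → ⟦ ℤ.- i ⟧ℤ ≈ - ⟦ i ⟧ℤ
  ⟦⟧-neg (+ ℕ.zero)  = sym -0#≈0#
  ⟦⟧-neg (+ ℕ.suc n) = refl
  ⟦⟧-neg -[1+ n ]    = sym (-‿involutive _)

  isZero : ℤ → Bool
  isZero (+ ℕ.zero) = true
  isZero _          = false

  homomorphism : Homomorphism _ _ c ℓ
  homomorphism = record
    { from          = record { rawRing = ℤ.+-*-rawRing ; isZero = isZero }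
    ; to            = fromCommutativeRing R (λ _ → nothing)
    ; morphism      = record
      { ⟦_⟧ = ⟦_⟧ℤ ; +-homo = ⟦⟧-+ ; *-homo = ⟦⟧-* ; -‿homo = ⟦⟧-neg
      ; 0-homo = refl ; 1-homo = refl }
    ; Zero-C⟶Zero-R = λ { (+ ℕ.zero) _ → refl }
    }

  open import Tactic.RingSolver.Core.Expression public
    renaming (_⊕_ to _:+_; _⊗_ to _:*_; ⊝_ to :-_)
  open Eval (Homomorphism.rawRing homomorphism) ⟦_⟧ℤ public
  open import Tactic.RingSolver.Core.Polynomial.Base (Homomorphism.from homomorphism)
    using (κ; ι; _⊞_; _⊠_; ⊟_; _⊡_) renaming (Poly to HornerPoly)
  open import Tactic.RingSolver.Core.Polynomial.Semantics homomorphism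
    renaming (⟦_⟧ to ⟦_⟧ₕ)
  open import Tactic.RingSolver.Core.Polynomial.Homomorphism homomorphism

  normalise : ∀ {n} → Expr ℤ n → HornerPoly n
  normalise (Κ x)    = κ x
  normalise (Ι x)    = ι x
  normalise (x :+ y) = normalise x ⊞ normalise y
  normalise (x :* y) = normalise x ⊠ normalise y
  normalise (:- x)   = ⊟ normalise x
  normalise (x ⊛ i)  = normalise x ⊡ i

  ⟦_⇓⟧ : ∀ {n} → Expr ℤ n → Vec Carrier n → Carrier
  ⟦ e ⇓⟧ = ⟦ normalise e ⟧ₕ

  normalise-correct : ∀ {n} (e : Expr ℤ n) ρ → ⟦ e ⇓⟧ ρ ≈ ⟦ e ⟧ ρ
  normalise-correct (Κ x)    ρ = κ-hom x ρ
  normalise-correct (Ι x)    ρ = ι-hom x ρ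
  normalise-correct (x :+ y) ρ = trans (⊞-hom (normalise x) (normalise y) ρ)
                                       (+-cong (normalise-correct x ρ) (normalise-correct y ρ))
  normalise-correct (x :* y) ρ = trans (⊠-hom (normalise x) (normalise y) ρ)
                                       (*-cong (normalise-correct x ρ) (normalise-correct y ρ))
  normalise-correct (:- x)   ρ = trans (⊟-hom (normalise x) ρ) (-‿cong (normalise-correct x ρ))
  normalise-correct (x ⊛ i)  ρ = trans (⊡-hom (normalise x) i ρ) (^-congˡ i (normalise-correct x ρ))

  open import Relation.Binary.Reflection setoid Ι ⟦_⟧ ⟦_⇓⟧ normalise-correct public
    using (solve; _⊜_)

  infixl 6 _:-_
  _:-_ : ∀ {n} → Expr ℤ n → Expr ℤ n → Expr ℤ n
  x :- y = x :+ :- y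

  :0 :1 : ∀ {n} → Expr ℤ n
  :0 = Κ (+ 0)
  :1 = Κ (+ 1)

module CommutativeRingProperties {c ℓ} (R : CommutativeRing c ℓ) where
  open CommutativeRing R
  open ℤCoefficientSolver R
  open import Algebra.Properties.Group +-group using (x≈y⇒x∙y⁻¹≈ε; ε⁻¹≈ε)
  open import Relation.Binary.Reasoning.Setoid setoid

  x≈0⇒y*x≈0 : ∀ y {x} → x ≈ 0# → y * x ≈ 0#
  x≈0⇒y*x≈0 y x≈0 = trans (*-congˡ x≈0) (zeroʳ y)

  x≈0∧y≈0⇒s*x-t*y≈0 : ∀ s t {x y} → x ≈ 0# → y ≈ 0# → s * x - t * y ≈ 0#
  x≈0∧y≈0⇒s*x-t*y≈0 s t {x} {y} x≈0 y≈0 = begin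
    s * x - t * y     ≈⟨ +-cong (x≈0⇒y*x≈0 s x≈0) (-‿cong (x≈0⇒y*x≈0 t y≈0)) ⟩
    0# - 0#           ≈⟨ -‿inverseʳ 0# ⟩
    0#                ∎

  x-y≈x′-y′⇒y-y′≈x-x′ : ∀ {x y x′ y′} → x - y ≈ x′ - y′ → y - y′ ≈ x - x′
  x-y≈x′-y′⇒y-y′≈x-x′ {x} {y} {x′} {y′} eq = begin
    y - y′                          ≈⟨ identity x y x′ y′ ⟩
    (x - x′) - ((x - y) - (x′ - y′)) ≈⟨ +-congˡ (-‿cong (x≈y⇒x∙y⁻¹≈ε eq)) ⟩
    (x - x′) - 0#                    ≈⟨ +-congˡ ε⁻¹≈ε ⟩
    (x - x′) + 0#                    ≈⟨ +-identityʳ _ ⟩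
    x - x′                          ∎
    where
    identity : ∀ x y x′ y′ → y - y′ ≈ (x - x′) - ((x - y) - (x′ - y′))
    identity = solve 4 (λ x y x′ y′ → y :- y′ ⊜ (x :- x′) :- ((x :- y) :- (x′ :- y′))) refl

module FiniteDecSetoid {a ℓ} (S : DecSetoid a ℓ) {xs : List (DecSetoid.Carrier S)}
                       (enumeration : IsEnumeration (DecSetoid.setoid S) xs) where
  open DecSetoid S
  open UniqueSetoid setoid using (Unique)

  search : ∀ {p} {P : Carrier → Set p} → P Respects _≈_ → (∀ x → Dec (P x)) → Dec (∃ P)
  search resp P? with any? P? xs
  ... | yes Pxs = yes (Any.satisfied Pxs)
  ... | no ¬Pxs = no λ (x , Px) → ¬Pxs (Any.map (λ x≈y → resp x≈y Px) (enumeration x))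

  unique⇒lookup-injective : ∀ {ys} → Unique ys → ∀ i j → lookup ys i ≈ lookup ys j → i ≡ j
  unique⇒lookup-injective (_   ∷ _)   zero    zero    _   = ≡.refl
  unique⇒lookup-injective (y≉ ∷ _)   zero    (suc j) y≈  = contradiction y≈ (All.lookup y≉ (∈-lookup j))
  unique⇒lookup-injective (y≉ ∷ _)   (suc i) zero    y≈  = contradiction (sym y≈) (All.lookup y≉ (∈-lookup i))
  unique⇒lookup-injective (_   ∷ ys!) (suc i) (suc j) eq =
    ≡.cong suc (unique⇒lookup-injective ys! i j eq)

  -- If t were not in the image, t and the images of the n distinct entries
  -- of the deduplicated enumeration would be n + 1 distinct elements.
  injective⇒strictlySurjective : ∀ {f : Carrier → Carrier} → Congruent _≈_ _≈_ f →
                                 Injective _≈_ _≈_ f → StrictlySurjective _≈_ f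
  injective⇒strictlySurjective {f} f-cong f-inj t
    with search (λ x≈y fx≈t → trans (sym (f-cong x≈y)) fx≈t) (λ x → f x ≟ t)
  ... | yes t∈image = t∈image
  ... | no t∉image  = contradiction (injective⇒≤ t∷images-injective) 1+n≰n
    where
    ys = deduplicate _≟_ xs

    position : Carrier → Fin (length ys)
    position x = index (deduplicate⁺ S enumeration x)

    position-injective : ∀ x y → position x ≡ position y → x ≈ y
    position-injective x y eq = trans (lookup-index (deduplicate⁺ S enumeration x))
      (≡.subst (λ i → lookup ys i ≈ y) (≡.sym eq) (sym (lookup-index (deduplicate⁺ S enumeration y))))

    t∷images : Fin (ℕ.suc (length ys)) → Fin (length ys)
    t∷images zero    = position t
    t∷images (suc i) = position (f (lookup ys i))

    t∷images-injective : ∀ {i j} → t∷images i ≡ t∷images j → i ≡ j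
    t∷images-injective {zero}  {zero}  _  = ≡.refl
    t∷images-injective {zero}  {suc j} eq = contradiction (_ , sym (position-injective _ _ eq)) t∉image
    t∷images-injective {suc i} {zero}  eq = contradiction (_ , position-injective _ _ eq) t∉image
    t∷images-injective {suc i} {suc j} eq = ≡.cong suc
      (unique⇒lookup-injective (deduplicate-! S xs) i j (f-inj (position-injective _ _ eq)))

module _ {c ℓ} (𝔽 : FiniteField c ℓ) where
  open FiniteField 𝔽 hiding (zero)
  open ℤCoefficientSolver commRing
  open CommutativeRingProperties commRing
  open import Algebra.Properties.Group +-group using (x∙y⁻¹≈ε⇒x≈y; x≈y⇒x∙y⁻¹≈ε; ε⁻¹≈ε; ⁻¹-injective)
  open import Relation.Binary.Reasoning.Setoid setoid

  x≉0∧x*y≈0⇒y≈0 : ∀ {x y} → ¬ x ≈ 0# → x * y ≈ 0# → y ≈ 0#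
  x≉0∧x*y≈0⇒y≈0 {x} {y} x≉0 xy≈0 with inverse x x≉0
  ... | x⁻¹ , xx⁻¹≈1 = begin
    y               ≈⟨ *-identityˡ y ⟨
    1# * y          ≈⟨ *-congʳ xx⁻¹≈1 ⟨
    (x * x⁻¹) * y   ≈⟨ *-congʳ (*-comm x x⁻¹) ⟩
    (x⁻¹ * x) * y   ≈⟨ *-assoc x⁻¹ x y ⟩
    x⁻¹ * (x * y)   ≈⟨ *-congˡ xy≈0 ⟩
    x⁻¹ * 0#        ≈⟨ zeroʳ x⁻¹ ⟩
    0#              ∎

  x≉0∧y≉0⇒x*y≉0 : ∀ {x y} → ¬ x ≈ 0# → ¬ y ≈ 0# → ¬ x * y ≈ 0#
  x≉0∧y≉0⇒x*y≉0 x≉0 y≉0 xy≈0 = y≉0 (x≉0∧x*y≈0⇒y≈0 x≉0 xy≈0)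

  det≉0⇒trivial-solution : ∀ {p q α β a b} → ¬ p * β - q * α ≈ 0# →
    a * p + b * α ≈ 0# → a * q + b * β ≈ 0# → a ≈ 0# × b ≈ 0#
  det≉0⇒trivial-solution {p} {q} {α} {β} {a} {b} det≉0 e₁ e₂ =
      x≉0∧x*y≈0⇒y≈0 det≉0 (trans (a-eliminated p q α β a b) (x≈0∧y≈0⇒s*x-t*y≈0 β α e₁ e₂))
    , x≉0∧x*y≈0⇒y≈0 det≉0 (trans (b-eliminated p q α β a b) (x≈0∧y≈0⇒s*x-t*y≈0 p q e₂ e₁))
    where
    a-eliminated : ∀ p q α β a b → (p * β - q * α) * a ≈ β * (a * p + b * α) - α * (a * q + b * β)
    a-eliminated = solve 6 (λ p q α β a b →
      (p :* β :- q :* α) :* a ⊜ β :* (a :* p :+ b :* α) :- α :* (a :* q :+ b :* β)) refl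
    b-eliminated : ∀ p q α β a b → (p * β - q * α) * b ≈ p * (a * q + b * β) - q * (a * p + b * α)
    b-eliminated = solve 6 (λ p q α β a b →
      (p :* β :- q :* α) :* b ⊜ p :* (a :* q :+ b :* β) :- q :* (a :* p :+ b :* α)) refl

  isotropic-in-hyperplane : ∀ p q r s → ¬ (p ≈ 0# × q ≈ 0#) →
    Σ (Carrier × Carrier × Carrier × Carrier) λ (α , β , γ , δ) →
      (α * δ + β * γ ≈ 0#) × (p * δ + s * α + q * γ + r * β ≈ 0#) × ¬ p * β - q * α ≈ 0#
  isotropic-in-hyperplane p q r s p,q≉0 with p ≟ 0# | q ≟ 0#
  ... | no p≉0 | _ = (0# , p , 0# , - r) , isotropic p r , orthogonal p q r s ,
                       λ det≈0 → x≉0∧y≉0⇒x*y≉0 p≉0 p≉0 (trans (sym (det p q)) det≈0)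
    where
    isotropic : ∀ p r → 0# * - r + p * 0# ≈ 0#
    isotropic = solve 2 (λ p r → :0 :* :- r :+ p :* :0 ⊜ :0) refl
    orthogonal : ∀ p q r s → p * - r + s * 0# + q * 0# + r * p ≈ 0#
    orthogonal = solve 4 (λ p q r s → p :* :- r :+ s :* :0 :+ q :* :0 :+ r :* p ⊜ :0) refl
    det : ∀ p q → p * p - q * 0# ≈ p * p
    det = solve 2 (λ p q → p :* p :- q :* :0 ⊜ p :* p) refl
  ... | yes _ | no q≉0 = (- q , 0# , s , 0#) , isotropic q s , orthogonal p q r s ,
                       λ det≈0 → x≉0∧y≉0⇒x*y≉0 q≉0 q≉0 (trans (sym (det p q)) det≈0)
    where
    isotropic : ∀ q s → - q * 0# + 0# * s ≈ 0#
    isotropic = solve 2 (λ q s → :- q :* :0 :+ :0 :* s ⊜ :0) refl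
    orthogonal : ∀ p q r s → p * 0# + s * - q + q * s + r * 0# ≈ 0#
    orthogonal = solve 4 (λ p q r s → p :* :0 :+ s :* :- q :+ q :* s :+ r :* :0 ⊜ :0) refl
    det : ∀ p q → p * 0# - q * - q ≈ q * q
    det = solve 2 (λ p q → p :* :0 :- q :* :- q ⊜ q :* q) refl
  ... | yes p≈0 | yes q≈0 = contradiction (p≈0 , q≈0) p,q≉0

  -- The quadric Q⁺(5,q)

  V : Set c
  V = V6 𝔽

  infix  4 _≋_
  infixl 6 _+ᵥ_
  infixr 7 _·ᵥ_

  _≋_ : V → V → Set ℓ
  _≋_ = _≈ᵥ_ 𝔽

  _+ᵥ_ : V → V → V
  _+ᵥ_ = _⊕_ 𝔽

  _·ᵥ_ : Carrier → V → V
  _·ᵥ_ = _·_ 𝔽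

  Q : V → Carrier
  Q = Qform 𝔽

  polar : V → V → Carrier
  polar u v = u (# 0) * v (# 5) + u (# 5) * v (# 0) + u (# 1) * v (# 4)
            + u (# 4) * v (# 1) + u (# 2) * v (# 3) + u (# 3) * v (# 2)

  span : Carrier → Carrier → Carrier → V → V → V → V
  span a b c u v w = a ·ᵥ u +ᵥ b ·ᵥ v +ᵥ c ·ᵥ w

  Q-cong : ∀ {u v} → u ≋ v → Q u ≈ Q v
  Q-cong u≋v = +-cong (+-cong (*-cong (u≋v (# 0)) (u≋v (# 5))) (*-cong (u≋v (# 1)) (u≋v (# 4))))
                      (*-cong (u≋v (# 2)) (u≋v (# 3)))

  polar-cong : ∀ {u u′ v v′} → u ≋ u′ → v ≋ v′ → polar u v ≈ polar u′ v′
  polar-cong u≋ v≋ = +-cong (+-cong (+-cong (+-cong (+-cong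
    (*-cong (u≋ (# 0)) (v≋ (# 5))) (*-cong (u≋ (# 5)) (v≋ (# 0))))
    (*-cong (u≋ (# 1)) (v≋ (# 4)))) (*-cong (u≋ (# 4)) (v≋ (# 1))))
    (*-cong (u≋ (# 2)) (v≋ (# 3)))) (*-cong (u≋ (# 3)) (v≋ (# 2)))

  Q-+ᵥ : ∀ u v → Q (u +ᵥ v) ≈ Q u + Q v + polar u v
  Q-+ᵥ u v = identity (u (# 0)) (u (# 1)) (u (# 2)) (u (# 3)) (u (# 4)) (u (# 5))
                      (v (# 0)) (v (# 1)) (v (# 2)) (v (# 3)) (v (# 4)) (v (# 5))
    where
    identity : ∀ u₀ u₁ u₂ u₃ u₄ u₅ v₀ v₁ v₂ v₃ v₄ v₅ →
      (u₀ + v₀) * (u₅ + v₅) + (u₁ + v₁) * (u₄ + v₄) + (u₂ + v₂) * (u₃ + v₃)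
      ≈ (u₀ * u₅ + u₁ * u₄ + u₂ * u₃) + (v₀ * v₅ + v₁ * v₄ + v₂ * v₃)
        + (u₀ * v₅ + u₅ * v₀ + u₁ * v₄ + u₄ * v₁ + u₂ * v₃ + u₃ * v₂)
    identity = solve 12 (λ u₀ u₁ u₂ u₃ u₄ u₅ v₀ v₁ v₂ v₃ v₄ v₅ →
      (u₀ :+ v₀) :* (u₅ :+ v₅) :+ (u₁ :+ v₁) :* (u₄ :+ v₄) :+ (u₂ :+ v₂) :* (u₃ :+ v₃)
      ⊜ (u₀ :* u₅ :+ u₁ :* u₄ :+ u₂ :* u₃) :+ (v₀ :* v₅ :+ v₁ :* v₄ :+ v₂ :* v₃)
        :+ (u₀ :* v₅ :+ u₅ :* v₀ :+ u₁ :* v₄ :+ u₄ :* v₁ :+ u₂ :* v₃ :+ u₃ :* v₂)) refl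

  Q-·ᵥ : ∀ a u → Q (a ·ᵥ u) ≈ a * a * Q u
  Q-·ᵥ a u = identity a (u (# 0)) (u (# 1)) (u (# 2)) (u (# 3)) (u (# 4)) (u (# 5))
    where
    identity : ∀ a u₀ u₁ u₂ u₃ u₄ u₅ →
      (a * u₀) * (a * u₅) + (a * u₁) * (a * u₄) + (a * u₂) * (a * u₃)
      ≈ a * a * (u₀ * u₅ + u₁ * u₄ + u₂ * u₃)
    identity = solve 7 (λ a u₀ u₁ u₂ u₃ u₄ u₅ →
      (a :* u₀) :* (a :* u₅) :+ (a :* u₁) :* (a :* u₄) :+ (a :* u₂) :* (a :* u₃)
      ⊜ a :* a :* (u₀ :* u₅ :+ u₁ :* u₄ :+ u₂ :* u₃)) refl

  polar-·ᵥ : ∀ a b u v → polar (a ·ᵥ u) (b ·ᵥ v) ≈ a * b * polar u v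
  polar-·ᵥ a b u v = identity a b (u (# 0)) (u (# 1)) (u (# 2)) (u (# 3)) (u (# 4)) (u (# 5))
                                  (v (# 0)) (v (# 1)) (v (# 2)) (v (# 3)) (v (# 4)) (v (# 5))
    where
    identity : ∀ a b u₀ u₁ u₂ u₃ u₄ u₅ v₀ v₁ v₂ v₃ v₄ v₅ →
      (a * u₀) * (b * v₅) + (a * u₅) * (b * v₀) + (a * u₁) * (b * v₄)
        + (a * u₄) * (b * v₁) + (a * u₂) * (b * v₃) + (a * u₃) * (b * v₂)
      ≈ a * b * (u₀ * v₅ + u₅ * v₀ + u₁ * v₄ + u₄ * v₁ + u₂ * v₃ + u₃ * v₂)
    identity = solve 14 (λ a b u₀ u₁ u₂ u₃ u₄ u₅ v₀ v₁ v₂ v₃ v₄ v₅ →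
      (a :* u₀) :* (b :* v₅) :+ (a :* u₅) :* (b :* v₀) :+ (a :* u₁) :* (b :* v₄)
        :+ (a :* u₄) :* (b :* v₁) :+ (a :* u₂) :* (b :* v₃) :+ (a :* u₃) :* (b :* v₂)
      ⊜ a :* b :* (u₀ :* v₅ :+ u₅ :* v₀ :+ u₁ :* v₄ :+ u₄ :* v₁ :+ u₂ :* v₃ :+ u₃ :* v₂)) refl

  polar-+ᵥˡ : ∀ u v w → polar (u +ᵥ v) w ≈ polar u w + polar v w
  polar-+ᵥˡ u v w = identity (u (# 0)) (u (# 1)) (u (# 2)) (u (# 3)) (u (# 4)) (u (# 5))
                             (v (# 0)) (v (# 1)) (v (# 2)) (v (# 3)) (v (# 4)) (v (# 5))
                             (w (# 0)) (w (# 1)) (w (# 2)) (w (# 3)) (w (# 4)) (w (# 5))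
    where
    identity : ∀ u₀ u₁ u₂ u₃ u₄ u₅ v₀ v₁ v₂ v₃ v₄ v₅ w₀ w₁ w₂ w₃ w₄ w₅ →
      (u₀ + v₀) * w₅ + (u₅ + v₅) * w₀ + (u₁ + v₁) * w₄
        + (u₄ + v₄) * w₁ + (u₂ + v₂) * w₃ + (u₃ + v₃) * w₂
      ≈ (u₀ * w₅ + u₅ * w₀ + u₁ * w₄ + u₄ * w₁ + u₂ * w₃ + u₃ * w₂)
        + (v₀ * w₅ + v₅ * w₀ + v₁ * w₄ + v₄ * w₁ + v₂ * w₃ + v₃ * w₂)
    identity = solve 18 (λ u₀ u₁ u₂ u₃ u₄ u₅ v₀ v₁ v₂ v₃ v₄ v₅ w₀ w₁ w₂ w₃ w₄ w₅ →
      (u₀ :+ v₀) :* w₅ :+ (u₅ :+ v₅) :* w₀ :+ (u₁ :+ v₁) :* w₄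
        :+ (u₄ :+ v₄) :* w₁ :+ (u₂ :+ v₂) :* w₃ :+ (u₃ :+ v₃) :* w₂
      ⊜ (u₀ :* w₅ :+ u₅ :* w₀ :+ u₁ :* w₄ :+ u₄ :* w₁ :+ u₂ :* w₃ :+ u₃ :* w₂)
        :+ (v₀ :* w₅ :+ v₅ :* w₀ :+ v₁ :* w₄ :+ v₄ :* w₁ :+ v₂ :* w₃ :+ v₃ :* w₂)) refl

  sum-singular : ∀ u v → Q u ≈ 0# → Q v ≈ 0# → polar u v ≈ 0# → Q (u +ᵥ v) ≈ 0#
  sum-singular u v Qu≈0 Qv≈0 u⊥v = begin
    Q (u +ᵥ v)               ≈⟨ Q-+ᵥ u v ⟩
    Q u + Q v + polar u v    ≈⟨ +-cong (+-cong Qu≈0 Qv≈0) u⊥v ⟩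
    0# + 0# + 0#             ≈⟨ trans (+-identityʳ _) (+-identityʳ 0#) ⟩
    0#                       ∎

  scale-singular : ∀ a u → Q u ≈ 0# → Q (a ·ᵥ u) ≈ 0#
  scale-singular a u Qu≈0 = trans (Q-·ᵥ a u) (x≈0⇒y*x≈0 (a * a) Qu≈0)

  scale-orthogonal : ∀ a b u v → polar u v ≈ 0# → polar (a ·ᵥ u) (b ·ᵥ v) ≈ 0#
  scale-orthogonal a b u v u⊥v = trans (polar-·ᵥ a b u v) (x≈0⇒y*x≈0 (a * b) u⊥v)

  sum-orthogonal : ∀ u v w → polar u w ≈ 0# → polar v w ≈ 0# → polar (u +ᵥ v) w ≈ 0#
  sum-orthogonal u v w u⊥w v⊥w =
    trans (polar-+ᵥˡ u v w) (trans (+-cong u⊥w v⊥w) (+-identityʳ 0#))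

  span-singular : ∀ {u v w} → Q u ≈ 0# → Q v ≈ 0# → Q w ≈ 0# →
    polar u v ≈ 0# → polar u w ≈ 0# → polar v w ≈ 0# → ∀ a b c → Q (span a b c u v w) ≈ 0#
  span-singular {u} {v} {w} Qu≈0 Qv≈0 Qw≈0 u⊥v u⊥w v⊥w a b c =
    sum-singular (a ·ᵥ u +ᵥ b ·ᵥ v) (c ·ᵥ w)
      (sum-singular (a ·ᵥ u) (b ·ᵥ v)
        (scale-singular a u Qu≈0) (scale-singular b v Qv≈0) (scale-orthogonal a b u v u⊥v))
      (scale-singular c w Qw≈0)
      (sum-orthogonal (a ·ᵥ u) (b ·ᵥ v) (c ·ᵥ w)
        (scale-orthogonal a c u w u⊥w) (scale-orthogonal b c v w v⊥w))

  span-+ᵥ : ∀ a b c a′ b′ c′ u v w →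
    span a b c u v w +ᵥ span a′ b′ c′ u v w ≋ span (a + a′) (b + b′) (c + c′) u v w
  span-+ᵥ a b c a′ b′ c′ u v w k = identity a b c a′ b′ c′ (u k) (v k) (w k)
    where
    identity : ∀ a b c a′ b′ c′ u v w →
      (a * u + b * v + c * w) + (a′ * u + b′ * v + c′ * w) ≈ (a + a′) * u + (b + b′) * v + (c + c′) * w
    identity = solve 9 (λ a b c a′ b′ c′ u v w →
      (a :* u :+ b :* v :+ c :* w) :+ (a′ :* u :+ b′ :* v :+ c′ :* w)
      ⊜ (a :+ a′) :* u :+ (b :+ b′) :* v :+ (c :+ c′) :* w) refl

  span-·ᵥ : ∀ e a b c u v w → e ·ᵥ span a b c u v w ≋ span (e * a) (e * b) (e * c) u v w
  span-·ᵥ e a b c u v w k = identity e a b c (u k) (v k) (w k)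
    where
    identity : ∀ e a b c u v w → e * (a * u + b * v + c * w) ≈ (e * a) * u + (e * b) * v + (e * c) * w
    identity = solve 7 (λ e a b c u v w →
      e :* (a :* u :+ b :* v :+ c :* w) ⊜ (e :* a) :* u :+ (e :* b) :* v :+ (e :* c) :* w) refl

  span-cong : ∀ {a b c a′ b′ c′} u v w → a ≈ a′ → b ≈ b′ → c ≈ c′ → span a b c u v w ≋ span a′ b′ c′ u v w
  span-cong u v w a≈ b≈ c≈ k = +-cong (+-cong (*-congʳ a≈) (*-congʳ b≈)) (*-congʳ c≈)

  𝔽ₛ : DecSetoid c ℓ
  𝔽ₛ = record
    { Carrier          = Carrier
    ; _≈_              = _≈_
    ; isDecEquivalence = record { isEquivalence = isEquivalence ; _≟_ = _≟_ }
    }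

  𝔽³ 𝔽⁵ : DecSetoid c ℓ
  𝔽³ = ×-decSetoid 𝔽ₛ (×-decSetoid 𝔽ₛ 𝔽ₛ)
  𝔽⁵ = ×-decSetoid 𝔽ₛ (×-decSetoid 𝔽ₛ 𝔽³)

  𝔽³-enumeration : IsEnumeration (DecSetoid.setoid 𝔽³)
                                  (cartesianProduct elements (cartesianProduct elements elements))
  𝔽³-enumeration = cartesianProduct⁺ setoid (DecSetoid.setoid (×-decSetoid 𝔽ₛ 𝔽ₛ)) complete
                     (cartesianProduct⁺ setoid setoid complete complete)

  𝔽⁵-enumeration : IsEnumeration (DecSetoid.setoid 𝔽⁵)
    (cartesianProduct elements (cartesianProduct elements
      (cartesianProduct elements (cartesianProduct elements elements))))
  𝔽⁵-enumeration = cartesianProduct⁺ setoid (DecSetoid.setoid (×-decSetoid 𝔽ₛ 𝔽³)) complete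
                     (cartesianProduct⁺ setoid (DecSetoid.setoid 𝔽³) complete 𝔽³-enumeration)

  e₅ : V
  e₅ = vec6 𝔽 0# 0# 0# 0# 0# 1#

  infix 4 _≈⁵_
  _≈⁵_ : V → V → Set ℓ
  u ≈⁵ v = ∀ (i : Fin 5) → u (inject₁ i) ≈ v (inject₁ i)

  ≈⁵∧last⇒≋ : ∀ {u v} → u ≈⁵ v → u (fromℕ 5) ≈ v (fromℕ 5) → u ≋ v
  ≈⁵∧last⇒≋ u≈⁵v u₅≈v₅ k with view k
  ... | ‵fromℕ     = u₅≈v₅
  ... | ‵inject₁ i = u≈⁵v i

  e₅≈⁵0 : e₅ ≈⁵ (λ _ → 0#)
  e₅≈⁵0 zero                         = refl
  e₅≈⁵0 (suc zero)                   = refl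
  e₅≈⁵0 (suc (suc zero))             = refl
  e₅≈⁵0 (suc (suc (suc zero)))       = refl
  e₅≈⁵0 (suc (suc (suc (suc zero)))) = refl

  infix 4 _≈₅_
  _≈₅_ : Rel (DecSetoid.Carrier 𝔽⁵) ℓ
  _≈₅_ = DecSetoid._≈_ 𝔽⁵

  first-five : V → DecSetoid.Carrier 𝔽⁵
  first-five v = v (# 0) , v (# 1) , v (# 2) , v (# 3) , v (# 4)

  first-five-cong : ∀ {u v} → u ≋ v → first-five u ≈₅ first-five v
  first-five-cong u≋v = u≋v (# 0) , u≋v (# 1) , u≋v (# 2) , u≋v (# 3) , u≋v (# 4)

  ≈₅-first-five⇒≈⁵ : ∀ u v → first-five u ≈₅ first-five v → u ≈⁵ v
  ≈₅-first-five⇒≈⁵ _ _ (e₀ , _  , _  , _  , _ ) zero                         = e₀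
  ≈₅-first-five⇒≈⁵ _ _ (_  , e₁ , _  , _  , _ ) (suc zero)                   = e₁
  ≈₅-first-five⇒≈⁵ _ _ (_  , _  , e₂ , _  , _ ) (suc (suc zero))             = e₂
  ≈₅-first-five⇒≈⁵ _ _ (_  , _  , _  , e₃ , _ ) (suc (suc (suc zero)))       = e₃
  ≈₅-first-five⇒≈⁵ _ _ (_  , _  , _  , _  , e₄) (suc (suc (suc (suc zero)))) = e₄

  span-difference : ∀ a b c a′ b′ c′ u v w k →
    span (a - a′) (b - b′) (c - c′) u v w k ≈ span a b c u v w k - span a′ b′ c′ u v w k
  span-difference a b c a′ b′ c′ u v w k = identity a b c a′ b′ c′ (u k) (v k) (w k)
    where
    identity : ∀ a b c a′ b′ c′ u v w →
      (a - a′) * u + (b - b′) * v + (c - c′) * w ≈ (a * u + b * v + c * w) - (a′ * u + b′ * v + c′ * w)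
    identity = solve 9 (λ a b c a′ b′ c′ u v w →
      (a :- a′) :* u :+ (b :- b′) :* v :+ (c :- c′) :* w
      ⊜ (a :* u :+ b :* v :+ c :* w) :- (a′ :* u :+ b′ :* v :+ c′ :* w)) refl

  module _ (π : Generator 𝔽) where
    open Generator π

    InPlane-singular : ∀ {x} → InPlane 𝔽 π x → Q x ≈ 0#
    InPlane-singular (a , b , c , x≋) = trans (Q-cong x≋) (singular a b c)

    InPlane-orthogonal : ∀ {x y} → InPlane 𝔽 π x → InPlane 𝔽 π y → polar x y ≈ 0#
    InPlane-orthogonal {x} {y} x∈π@(a , b , c , x≋) y∈π@(a′ , b′ , c′ , y≋) = begin
      polar x y               ≈⟨ trans (+-congʳ (+-identityʳ 0#)) (+-identityˡ _) ⟨
      0# + 0# + polar x y     ≈⟨ +-congʳ (+-cong (InPlane-singular x∈π) (InPlane-singular y∈π)) ⟨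
      Q x + Q y + polar x y   ≈⟨ Q-+ᵥ x y ⟨
      Q (x +ᵥ y)              ≈⟨ InPlane-singular (_ , _ , _ , x+y≋) ⟩
      0#                      ∎
      where
      x+y≋ : x +ᵥ y ≋ span (a + a′) (b + b′) (c + c′) u v w
      x+y≋ k = trans (+-cong (x≋ k) (y≋ k)) (span-+ᵥ a b c a′ b′ c′ u v w k)

    -- A nonzero vector of π vanishing off the last coordinate spans e₅.
    span≈⁵0⇒trivial : ¬ InPlane 𝔽 π e₅ → ∀ a b c →
      span a b c u v w ≈⁵ (λ _ → 0#) → a ≈ 0# × b ≈ 0# × c ≈ 0#
    span≈⁵0⇒trivial e₅∉π a b c d≈⁵0 with span a b c u v w (fromℕ 5) ≟ 0#
    ... | yes d₅≈0 = independent a b c (≈⁵∧last⇒≋ d≈⁵0 d₅≈0)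
    ... | no  d₅≉0 with inverse _ d₅≉0
    ...   | e , d₅e≈1 = contradiction (e * a , e * b , e * c , e₅≋) e₅∉π
      where
      scaled : ∀ k → span (e * a) (e * b) (e * c) u v w k ≈ e * span a b c u v w k
      scaled k = sym (span-·ᵥ e a b c u v w k)
      e₅≋ : e₅ ≋ span (e * a) (e * b) (e * c) u v w
      e₅≋ = ≈⁵∧last⇒≋ (λ i → trans (e₅≈⁵0 i) (sym (trans (scaled (inject₁ i)) (x≈0⇒y*x≈0 e (d≈⁵0 i)))))
                      (sym (trans (scaled (fromℕ 5)) (trans (*-comm e _) d₅e≈1)))

  nonzero-multiple⇒scalar≉0 : ∀ {x λ′ r} → NonZero 𝔽 x → x ≋ λ′ ·ᵥ r → ¬ λ′ ≈ 0#
  nonzero-multiple⇒scalar≉0 x≉0 x≋ λ′≈0 = x≉0 λ k → trans (x≋ k) (trans (*-congʳ λ′≈0) (zeroˡ _))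

  multiples⇒samePoint : ∀ {x y λ′ μ r} → ¬ λ′ ≈ 0# → x ≋ λ′ ·ᵥ r → y ≋ μ ·ᵥ r → SamePoint 𝔽 x y
  multiples⇒samePoint {x} {y} {λ′} {μ} {r} λ′≉0 x≋ y≋ with inverse λ′ λ′≉0
  ... | λ′⁻¹ , λ′λ′⁻¹≈1 = μ * λ′⁻¹ , λ k → begin
    y k                      ≈⟨ y≋ k ⟩
    μ * r k                  ≈⟨ *-congʳ (*-identityʳ μ) ⟨
    (μ * 1#) * r k           ≈⟨ *-congʳ (*-congˡ λ′λ′⁻¹≈1) ⟨
    (μ * (λ′ * λ′⁻¹)) * r k  ≈⟨ regroup μ λ′ λ′⁻¹ (r k) ⟩
    (μ * λ′⁻¹) * (λ′ * r k)  ≈⟨ *-congˡ (x≋ k) ⟨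
    (μ * λ′⁻¹) * x k         ∎
    where
    regroup : ∀ μ λ′ λ′⁻¹ r → (μ * (λ′ * λ′⁻¹)) * r ≈ (μ * λ′⁻¹) * (λ′ * r)
    regroup = solve 4 (λ μ λ′ λ′⁻¹ r → (μ :* (λ′ :* λ′⁻¹)) :* r ⊜ (μ :* λ′⁻¹) :* (λ′ :* r)) refl

  ^-cong : ∀ n {x y} → x ≈ y → _^_ 𝔽 x n ≈ _^_ 𝔽 y n
  ^-cong ℕ.zero    x≈y = refl
  ^-cong (ℕ.suc n) x≈y = *-cong x≈y (^-cong n x≈y)

  1^n≈1 : ∀ n → _^_ 𝔽 1# n ≈ 1#
  1^n≈1 ℕ.zero    = refl
  1^n≈1 (ℕ.suc n) = trans (*-identityˡ _) (1^n≈1 n)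

  eval-cong : ∀ f {x x′ y y′} → x ≈ x′ → y ≈ y′ → eval 𝔽 f x y ≈ eval 𝔽 f x′ y′
  eval-cong []              x≈ y≈ = refl
  eval-cong ((a , i , j) ∷ f) x≈ y≈ =
    +-cong (*-cong (*-congˡ (^-cong i x≈)) (^-cong j y≈)) (eval-cong f x≈ y≈)

  homSum-affine : ∀ d f x₁ y₁ x₂ y₂ → homSum 𝔽 d f 1# x₁ y₁ x₂ y₂ ≈ eval 𝔽 f x₂ y₂ - eval 𝔽 f x₁ y₁
  homSum-affine d []                x₁ y₁ x₂ y₂ = sym (-‿inverseʳ 0#)
  homSum-affine d ((a , i , j) ∷ f) x₁ y₁ x₂ y₂ = trans
    (+-cong (*-congˡ (1^n≈1 (d ∸ (i ℕ.+ j)))) (homSum-affine d f x₁ y₁ x₂ y₂))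
    (identity a (_^_ 𝔽 x₂ i) (_^_ 𝔽 y₂ j) (_^_ 𝔽 x₁ i) (_^_ 𝔽 y₁ j) (eval 𝔽 f x₂ y₂) (eval 𝔽 f x₁ y₁))
    where
    identity : ∀ a X₂ Y₂ X₁ Y₁ E₂ E₁ →
      a * (X₂ * Y₂ - X₁ * Y₁) * 1# + (E₂ - E₁) ≈ (a * X₂ * Y₂ + E₂) - (a * X₁ * Y₁ + E₁)
    identity = solve 7 (λ a X₂ Y₂ X₁ Y₁ E₂ E₁ →
      a :* (X₂ :* Y₂ :- X₁ :* Y₁) :* :1 :+ (E₂ :- E₁) ⊜ (a :* X₂ :* Y₂ :+ E₂) :- (a :* X₁ :* Y₁ :+ E₁)) refl

  -- The set O₅(f₁,f₂)

  module _ (f₁ f₂ : Poly 𝔽) where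

    A B : Carrier → Carrier → Carrier
    A = eval 𝔽 f₁
    B = eval 𝔽 f₂

    point : Carrier → Carrier → V
    point x y = rep 𝔽 f₁ f₂ (just (x , y))

    point-cong : ∀ {x x′ y y′} → x ≈ x′ → y ≈ y′ → point x y ≋ point x′ y′
    point-cong x≈ y≈ zero                                = refl
    point-cong x≈ y≈ (suc zero)                          = x≈
    point-cong x≈ y≈ (suc (suc zero))                    = y≈
    point-cong x≈ y≈ (suc (suc (suc zero)))              = eval-cong f₁ x≈ y≈
    point-cong x≈ y≈ (suc (suc (suc (suc zero))))        = eval-cong f₂ x≈ y≈
    point-cong x≈ y≈ (suc (suc (suc (suc (suc zero))))) =
      +-cong (-‿cong (*-cong x≈ (eval-cong f₂ x≈ y≈))) (-‿cong (*-cong y≈ (eval-cong f₁ x≈ y≈)))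

    rep-singular : ∀ i → Q (rep 𝔽 f₁ f₂ i) ≈ 0#
    rep-singular (just (x , y)) = identity x y (A x y) (B x y)
      where
      identity : ∀ x y a b → 1# * (- (x * b) - y * a) + x * b + y * a ≈ 0#
      identity = solve 4 (λ x y a b → :1 :* (:- (x :* b) :- y :* a) :+ x :* b :+ y :* a ⊜ :0) refl
    rep-singular nothing = identity
      where
      identity : 0# * 1# + 0# * 0# + 0# * 0# ≈ 0#
      identity = solve 0 (:0 :* :1 :+ :0 :* :0 :+ :0 :* :0 ⊜ :0) refl

    polar-point-point : ∀ x₁ y₁ x₂ y₂ → polar (point x₁ y₁) (point x₂ y₂) ≈ polyF 𝔽 f₁ f₂ 1# x₁ y₁ x₂ y₂
    polar-point-point x₁ y₁ x₂ y₂ = begin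
      polar (point x₁ y₁) (point x₂ y₂)
        ≈⟨ identity x₁ y₁ (A x₁ y₁) (B x₁ y₁) x₂ y₂ (A x₂ y₂) (B x₂ y₂) ⟩
      (y₁ - y₂) * (A x₂ y₂ - A x₁ y₁) + (x₁ - x₂) * (B x₂ y₂ - B x₁ y₁)
        ≈⟨ +-cong (*-congˡ (homSum-affine _ f₁ x₁ y₁ x₂ y₂)) (*-congˡ (homSum-affine _ f₂ x₁ y₁ x₂ y₂)) ⟨
      polyF 𝔽 f₁ f₂ 1# x₁ y₁ x₂ y₂
        ∎
      where
      identity : ∀ x₁ y₁ a₁ b₁ x₂ y₂ a₂ b₂ →
        1# * (- (x₂ * b₂) - y₂ * a₂) + (- (x₁ * b₁) - y₁ * a₁) * 1#
          + x₁ * b₂ + b₁ * x₂ + y₁ * a₂ + a₁ * y₂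
        ≈ (y₁ - y₂) * (a₂ - a₁) + (x₁ - x₂) * (b₂ - b₁)
      identity = solve 8 (λ x₁ y₁ a₁ b₁ x₂ y₂ a₂ b₂ →
        :1 :* (:- (x₂ :* b₂) :- y₂ :* a₂) :+ (:- (x₁ :* b₁) :- y₁ :* a₁) :* :1
          :+ x₁ :* b₂ :+ b₁ :* x₂ :+ y₁ :* a₂ :+ a₁ :* y₂
        ⊜ (y₁ :- y₂) :* (a₂ :- a₁) :+ (x₁ :- x₂) :* (b₂ :- b₁)) refl

    polar-point-e₅ : ∀ x y → polar (point x y) e₅ ≈ 1#
    polar-point-e₅ x y = identity x y (A x y) (B x y)
      where
      identity : ∀ x y a b →
        1# * 1# + (- (x * b) - y * a) * 0# + x * 0# + b * 0# + y * 0# + a * 0# ≈ 1#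
      identity = solve 4 (λ x y a b →
        :1 :* :1 :+ (:- (x :* b) :- y :* a) :* :0 :+ x :* :0 :+ b :* :0 :+ y :* :0 :+ a :* :0 ⊜ :1) refl

    polar-e₅-point : ∀ x y → polar e₅ (point x y) ≈ 1#
    polar-e₅-point x y = identity x y (A x y) (B x y)
      where
      identity : ∀ x y a b →
        0# * (- (x * b) - y * a) + 1# * 1# + 0# * b + 0# * x + 0# * a + 0# * y ≈ 1#
      identity = solve 4 (λ x y a b →
        :0 :* (:- (x :* b) :- y :* a) :+ :1 :* :1 :+ :0 :* b :+ :0 :* x :+ :0 :* a :+ :0 :* y ⊜ :1) refl

    O₅-singular : ∀ x → NonZero 𝔽 x → O₅ 𝔽 f₁ f₂ x → Q x ≈ 0#
    O₅-singular x _ (i , λ′ , x≋) = trans (Q-cong x≋) (scale-singular λ′ (rep 𝔽 f₁ f₂ i) (rep-singular i))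

    noAffinePoint⇒equal : NoAffinePointOutside 𝔽 f₁ f₂ → ∀ {x₁ y₁ x₂ y₂} →
      polyF 𝔽 f₁ f₂ 1# x₁ y₁ x₂ y₂ ≈ 0# → x₁ ≈ x₂ × y₁ ≈ y₂
    noAffinePoint⇒equal none {x₁} {y₁} {x₂} {y₂} F≈0 =
        x∙y⁻¹≈ε⇒x≈y x₁ x₂ (decidable-stable ((x₁ - x₂) ≟ 0#) λ x≉ → none (_ , _ , _ , _ , F≈0 , x≉ ∘ proj₁))
      , x∙y⁻¹≈ε⇒x≈y y₁ y₂ (decidable-stable ((y₁ - y₂) ≟ 0#) λ y≉ → none (_ , _ , _ , _ , F≈0 , y≉ ∘ proj₂))

    orthogonal-reps-coincide : NoAffinePointOutside 𝔽 f₁ f₂ →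
      ∀ i j → polar (rep 𝔽 f₁ f₂ i) (rep 𝔽 f₁ f₂ j) ≈ 0# → rep 𝔽 f₁ f₂ i ≋ rep 𝔽 f₁ f₂ j
    orthogonal-reps-coincide none (just (x₁ , y₁)) (just (x₂ , y₂)) ⊥≈0 =
      let x≈ , y≈ = noAffinePoint⇒equal none (trans (sym (polar-point-point x₁ y₁ x₂ y₂)) ⊥≈0)
      in  point-cong x≈ y≈
    orthogonal-reps-coincide none (just (x , y)) nothing ⊥≈0 =
      contradiction (trans (sym ⊥≈0) (polar-point-e₅ x y)) 0≉1
    orthogonal-reps-coincide none nothing (just (x , y)) ⊥≈0 =
      contradiction (trans (sym ⊥≈0) (polar-e₅-point x y)) 0≉1
    orthogonal-reps-coincide none nothing nothing _ _ = refl

    O₅-meets-generator-at-most-once : NoAffinePointOutside 𝔽 f₁ f₂ → ∀ π x y →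
      NonZero 𝔽 x → NonZero 𝔽 y → InPlane 𝔽 π x → InPlane 𝔽 π y →
      O₅ 𝔽 f₁ f₂ x → O₅ 𝔽 f₁ f₂ y → SamePoint 𝔽 x y
    O₅-meets-generator-at-most-once none π x y x≉0 y≉0 x∈π y∈π (i , λ′ , x≋) (j , μ , y≋) =
      multiples⇒samePoint λ′≉0 x≋ (λ k → trans (y≋ k) (*-congˡ (sym (rep≋ k))))
      where
      λ′≉0 = nonzero-multiple⇒scalar≉0 x≉0 x≋
      μ≉0  = nonzero-multiple⇒scalar≉0 y≉0 y≋
      rᵢ = rep 𝔽 f₁ f₂ i
      rⱼ = rep 𝔽 f₁ f₂ j
      rep≋ : rᵢ ≋ rⱼ
      rep≋ = orthogonal-reps-coincide none i j (x≉0∧x*y≈0⇒y≈0 (x≉0∧y≉0⇒x*y≉0 λ′≉0 μ≉0) (begin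
        λ′ * μ * polar rᵢ rⱼ         ≈⟨ polar-·ᵥ λ′ μ rᵢ rⱼ ⟨
        polar (λ′ ·ᵥ rᵢ) (μ ·ᵥ rⱼ)   ≈⟨ polar-cong x≋ y≋ ⟨
        polar x y                   ≈⟨ InPlane-orthogonal π x∈π y∈π ⟩
        0#                          ∎))

    singular∧≈⁵point⇒≋point : ∀ {v x y} → Q v ≈ 0# → v ≈⁵ point x y → v ≋ point x y
    singular∧≈⁵point⇒≋point {v} {x} {y} Qv≈0 v≈⁵ = ≈⁵∧last⇒≋ v≈⁵ (begin
      v₅                                                 ≈⟨ identity v₅ x y (A x y) (B x y) ⟩
      (1# * v₅ + x * B x y + y * A x y) + point x y (# 5) ≈⟨ +-congʳ Qv≈ ⟨
      Q v + point x y (# 5)                              ≈⟨ +-congʳ Qv≈0 ⟩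
      0# + point x y (# 5)                               ≈⟨ +-identityˡ _ ⟩
      point x y (# 5)                                    ∎)
      where
      v₅ = v (# 5)
      Qv≈ : Q v ≈ 1# * v₅ + x * B x y + y * A x y
      Qv≈ = +-cong (+-cong (*-congʳ (v≈⁵ (# 0))) (*-cong (v≈⁵ (# 1)) (v≈⁵ (# 4))))
                   (*-cong (v≈⁵ (# 2)) (v≈⁵ (# 3)))
      identity : ∀ v₅ x y a b → v₅ ≈ (1# * v₅ + x * b + y * a) + (- (x * b) - y * a)
      identity = solve 5 (λ v₅ x y a b →
        v₅ ⊜ (:1 :* v₅ :+ x :* b :+ y :* a) :+ (:- (x :* b) :- y :* a)) refl

    Q-difference-of-points : ∀ d x y x′ y′ →
      (∀ i → d (inject₁ i) ≈ point x y (inject₁ i) - point x′ y′ (inject₁ i)) →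
      Q d ≈ - polar (point x y) (point x′ y′)
    Q-difference-of-points d x y x′ y′ d≈ = begin
      Q d                  ≈⟨ +-cong (+-cong (*-congʳ (d≈ (# 0))) (*-cong (d≈ (# 1)) (d≈ (# 4))))
                                            (*-cong (d≈ (# 2)) (d≈ (# 3))) ⟩
      (1# - 1#) * d (# 5) + (x - x′) * (B x y - B x′ y′) + (y - y′) * (A x y - A x′ y′)
                           ≈⟨ identity (d (# 5)) x y (A x y) (B x y) x′ y′ (A x′ y′) (B x′ y′) ⟩
      - polar (point x y) (point x′ y′) ∎
      where
      identity : ∀ d₅ x y a b x′ y′ a′ b′ →
        (1# - 1#) * d₅ + (x - x′) * (b - b′) + (y - y′) * (a - a′)
        ≈ - (1# * (- (x′ * b′) - y′ * a′) + (- (x * b) - y * a) * 1#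
             + x * b′ + b * x′ + y * a′ + a * y′)
      identity = solve 9 (λ d₅ x y a b x′ y′ a′ b′ →
        (:1 :- :1) :* d₅ :+ (x :- x′) :* (b :- b′) :+ (y :- y′) :* (a :- a′)
        ⊜ :- (:1 :* (:- (x′ :* b′) :- y′ :* a′) :+ (:- (x :* b) :- y :* a) :* :1
              :+ x :* b′ :+ b :* x′ :+ y :* a′ :+ a :* y′)) refl

    module _ (none : NoAffinePointOutside 𝔽 f₁ f₂) (π : Generator 𝔽) where
      open Generator π

      offset : DecSetoid.Carrier 𝔽⁵ → V
      offset (x , y , a , b , c) k = point x y k - span a b c u v w k

      offset-cong : ∀ {p q} → p ≈₅ q → offset p ≋ offset q
      offset-cong (x≈ , y≈ , a≈ , b≈ , c≈) k =
        +-cong (point-cong x≈ y≈ k) (-‿cong (span-cong u v w a≈ b≈ c≈ k))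

      offset-injective : ¬ InPlane 𝔽 π e₅ → ∀ {p q} → offset p ≈⁵ offset q → p ≈₅ q
      offset-injective e₅∉π {x , y , a , b , c} {x′ , y′ , a′ , b′ , c′} offset≈⁵ =
          x≈x′ , y≈y′ , x∙y⁻¹≈ε⇒x≈y a a′ a-a′≈0 , x∙y⁻¹≈ε⇒x≈y b b′ b-b′≈0 , x∙y⁻¹≈ε⇒x≈y c c′ c-c′≈0
        where
        d : V
        d = span (a - a′) (b - b′) (c - c′) u v w
        d≈ : ∀ i → d (inject₁ i) ≈ point x y (inject₁ i) - point x′ y′ (inject₁ i)
        d≈ i = trans (span-difference a b c a′ b′ c′ u v w (inject₁ i))
                     (x-y≈x′-y′⇒y-y′≈x-x′ (offset≈⁵ i))
        orthogonal : polar (point x y) (point x′ y′) ≈ 0#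
        orthogonal = ⁻¹-injective (begin
          - polar (point x y) (point x′ y′) ≈⟨ Q-difference-of-points d x y x′ y′ d≈ ⟨
          Q d                              ≈⟨ InPlane-singular π (a - a′ , b - b′ , c - c′ , λ _ → refl) ⟩
          0#                               ≈⟨ ε⁻¹≈ε ⟨
          - 0#                             ∎)
        same = noAffinePoint⇒equal none (trans (sym (polar-point-point x y x′ y′)) orthogonal)
        x≈x′ = proj₁ same
        y≈y′ = proj₂ same
        d≈⁵0 : d ≈⁵ (λ _ → 0#)
        d≈⁵0 i = trans (d≈ i) (x≈y⇒x∙y⁻¹≈ε (point-cong x≈x′ y≈y′ (inject₁ i)))
        trivial = span≈⁵0⇒trivial π e₅∉π _ _ _ d≈⁵0
        a-a′≈0 = proj₁ trivial
        b-b′≈0 = proj₁ (proj₂ trivial)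
        c-c′≈0 = proj₂ (proj₂ trivial)

      e₅∈π? : Dec (InPlane 𝔽 π e₅)
      e₅∈π? = Dec.map′ (λ ((a , b , c) , e₅≋) → a , b , c , e₅≋) (λ (a , b , c , e₅≋) → (a , b , c) , e₅≋)
        (search (λ (a≈ , b≈ , c≈) e₅≋ k → trans (e₅≋ k) (span-cong u v w a≈ b≈ c≈ k))
                (λ (a , b , c) → all? (λ k → e₅ k ≟ span a b c u v w k)))
        where open FiniteDecSetoid 𝔽³ 𝔽³-enumeration

      preimage⇒meets : (∃ λ p → first-five (offset p) ≈₅ first-five (λ _ → 0#)) →
        Σ V λ x → NonZero 𝔽 x × InPlane 𝔽 π x × O₅ 𝔽 f₁ f₂ x
      preimage⇒meets ((x , y , a , b , c) , offset≈0) =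
        s , s≉0 , (a , b , c , λ _ → refl) , (just (x , y) , 1# , λ k → trans (s≋ k) (sym (*-identityˡ _)))
        where
        s = span a b c u v w
        s≋ : s ≋ point x y
        s≋ = singular∧≈⁵point⇒≋point (singular a b c)
               (λ i → sym (x∙y⁻¹≈ε⇒x≈y _ _ (≈₅-first-five⇒≈⁵ (offset (x , y , a , b , c)) (λ _ → 0#) offset≈0 i)))
        s≉0 : NonZero 𝔽 s
        s≉0 s≈0 = 0≉1 (trans (sym (s≈0 (# 0))) (s≋ (# 0)))

      O₅-meets-generator : Σ V λ x → NonZero 𝔽 x × InPlane 𝔽 π x × O₅ 𝔽 f₁ f₂ x
      O₅-meets-generator with e₅∈π?
      ... | yes e₅∈π = e₅ , (λ e₅≈0 → 0≉1 (sym (e₅≈0 (# 5)))) , e₅∈π , (nothing , 1# , λ k → sym (*-identityˡ _))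
      ... | no  e₅∉π = preimage⇒meets (injective⇒strictlySurjective
                         (first-five-cong ∘ offset-cong)
                         (λ {p} {q} → offset-injective e₅∉π ∘ ≈₅-first-five⇒≈⁵ (offset p) (offset q))
                         (first-five (λ _ → 0#)))
        where open FiniteDecSetoid 𝔽⁵ 𝔽⁵-enumeration

    point≉0 : ∀ x y → NonZero 𝔽 (point x y)
    point≉0 x y point≈0 = 0≉1 (sym (point≈0 (# 0)))

    point∈O₅ : ∀ x y → O₅ 𝔽 f₁ f₂ (point x y)
    point∈O₅ x y = just (x , y) , 1# , λ k → sym (*-identityˡ _)

    samePoint⇒equal : ∀ {x₁ y₁ x₂ y₂} → SamePoint 𝔽 (point x₁ y₁) (point x₂ y₂) → x₁ - x₂ ≈ 0# × y₁ - y₂ ≈ 0#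
    samePoint⇒equal {x₁} {y₁} {x₂} {y₂} (λ′ , P₂≋) =
      x≈y⇒x∙y⁻¹≈ε (sym (unscaled (# 1))) , x≈y⇒x∙y⁻¹≈ε (sym (unscaled (# 2)))
      where
      λ′≈1 : λ′ ≈ 1#
      λ′≈1 = trans (sym (*-identityʳ λ′)) (sym (P₂≋ (# 0)))
      unscaled : ∀ k → point x₂ y₂ k ≈ point x₁ y₁ k
      unscaled k = trans (P₂≋ k) (trans (*-congʳ λ′≈1) (*-identityˡ _))

    completion : Carrier → Carrier → Carrier → Carrier → Carrier → Carrier → V
    completion x y α β γ δ = vec6 𝔽 0# α β γ δ (- (x * δ + B x y * α + y * γ + A x y * β))

    Q-completion : ∀ x y α β γ δ → Q (completion x y α β γ δ) ≈ α * δ + β * γ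
    Q-completion x y α β γ δ = identity (completion x y α β γ δ (# 5)) α β γ δ
      where
      identity : ∀ w₅ α β γ δ → 0# * w₅ + α * δ + β * γ ≈ α * δ + β * γ
      identity = solve 5 (λ w₅ α β γ δ → :0 :* w₅ :+ α :* δ :+ β :* γ ⊜ α :* δ :+ β :* γ) refl

    polar-point-completion : ∀ x₁ y₁ x₂ y₂ α β γ δ →
      polar (point x₁ y₁) (completion x₂ y₂ α β γ δ)
      ≈ (x₁ - x₂) * δ + (B x₁ y₁ - B x₂ y₂) * α + (y₁ - y₂) * γ + (A x₁ y₁ - A x₂ y₂) * β
    polar-point-completion x₁ y₁ x₂ y₂ α β γ δ =
      identity x₁ y₁ (A x₁ y₁) (B x₁ y₁) x₂ y₂ (A x₂ y₂) (B x₂ y₂) α β γ δ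
      where
      identity : ∀ x₁ y₁ a₁ b₁ x₂ y₂ a₂ b₂ α β γ δ →
        1# * (- (x₂ * δ + b₂ * α + y₂ * γ + a₂ * β)) + (- (x₁ * b₁) - y₁ * a₁) * 0#
          + x₁ * δ + b₁ * α + y₁ * γ + a₁ * β
        ≈ (x₁ - x₂) * δ + (b₁ - b₂) * α + (y₁ - y₂) * γ + (a₁ - a₂) * β
      identity = solve 12 (λ x₁ y₁ a₁ b₁ x₂ y₂ a₂ b₂ α β γ δ →
        :1 :* (:- (x₂ :* δ :+ b₂ :* α :+ y₂ :* γ :+ a₂ :* β)) :+ (:- (x₁ :* b₁) :- y₁ :* a₁) :* :0
          :+ x₁ :* δ :+ b₁ :* α :+ y₁ :* γ :+ a₁ :* β
        ⊜ (x₁ :- x₂) :* δ :+ (b₁ :- b₂) :* α :+ (y₁ :- y₂) :* γ :+ (a₁ :- a₂) :* β) refl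

    polar-point-own-completion : ∀ x y α β γ δ → polar (point x y) (completion x y α β γ δ) ≈ 0#
    polar-point-own-completion x y α β γ δ =
      trans (polar-point-completion x y x y α β γ δ) (identity x y (A x y) (B x y) α β γ δ)
      where
      identity : ∀ x y a b α β γ δ → (x - x) * δ + (b - b) * α + (y - y) * γ + (a - a) * β ≈ 0#
      identity = solve 8 (λ x y a b α β γ δ →
        (x :- x) :* δ :+ (b :- b) :* α :+ (y :- y) :* γ :+ (a :- a) :* β ⊜ :0) refl

    span-points-completion-independent : ∀ {x₁ y₁ x₂ y₂ α β γ δ} → ¬ (x₁ - x₂) * β - (y₁ - y₂) * α ≈ 0# →
      ∀ a b c → span a b c (point x₁ y₁) (point x₂ y₂) (completion x₂ y₂ α β γ δ) ≋ (λ _ → 0#) →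
      a ≈ 0# × b ≈ 0# × c ≈ 0#
    span-points-completion-independent {x₁} {y₁} {x₂} {y₂} {α} {β} det≉0 a b c span≈0 =
      a≈0 , trans (b≈ a b c) (x≈0∧y≈0⇒s*x-t*y≈0 1# 1# (span≈0 (# 0)) a≈0) , c≈0
      where
      eliminate : ∀ a b c x₁ x₂ α →
        a * (x₁ - x₂) + c * α ≈ 1# * (a * x₁ + b * x₂ + c * α) - x₂ * (a * 1# + b * 1# + c * 0#)
      eliminate = solve 6 (λ a b c x₁ x₂ α →
        a :* (x₁ :- x₂) :+ c :* α
        ⊜ :1 :* (a :* x₁ :+ b :* x₂ :+ c :* α) :- x₂ :* (a :* :1 :+ b :* :1 :+ c :* :0)) refl
      b≈ : ∀ a b c → b ≈ 1# * (a * 1# + b * 1# + c * 0#) - 1# * a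
      b≈ = solve 3 (λ a b c → b ⊜ :1 :* (a :* :1 :+ b :* :1 :+ c :* :0) :- :1 :* a) refl
      a≈0,c≈0 = det≉0⇒trivial-solution det≉0
        (trans (eliminate a b c x₁ x₂ α) (x≈0∧y≈0⇒s*x-t*y≈0 1# x₂ (span≈0 (# 1)) (span≈0 (# 0))))
        (trans (eliminate a b c y₁ y₂ β) (x≈0∧y≈0⇒s*x-t*y≈0 1# y₂ (span≈0 (# 2)) (span≈0 (# 0))))
      a≈0 = proj₁ a≈0,c≈0
      c≈0 = proj₂ a≈0,c≈0

    generator-through : ∀ {x₁ y₁ x₂ y₂} → ¬ (x₁ - x₂ ≈ 0# × y₁ - y₂ ≈ 0#) →
      polar (point x₁ y₁) (point x₂ y₂) ≈ 0# →
      Σ (Generator 𝔽) λ π → InPlane 𝔽 π (point x₁ y₁) × InPlane 𝔽 π (point x₂ y₂)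
    generator-through {x₁} {y₁} {x₂} {y₂} distinct P₁⊥P₂
      with isotropic-in-hyperplane (x₁ - x₂) (y₁ - y₂) (A x₁ y₁ - A x₂ y₂) (B x₁ y₁ - B x₂ y₂) distinct
    ... | (α , β , γ , δ) , isotropic , orthogonal , det≉0 =
      π , (1# , 0# , 0# , λ k → first (P₁ k) (P₂ k) (W k)) , (0# , 1# , 0# , λ k → second (P₁ k) (P₂ k) (W k))
      where
      P₁ = point x₁ y₁
      P₂ = point x₂ y₂
      W  = completion x₂ y₂ α β γ δ
      π : Generator 𝔽
      π = record
        { u           = P₁
        ; v           = P₂
        ; w           = W
        ; independent = span-points-completion-independent det≉0
        ; singular    = span-singular {P₁} {P₂} {W} (rep-singular (just (x₁ , y₁))) (rep-singular (just (x₂ , y₂)))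
                          (trans (Q-completion x₂ y₂ α β γ δ) isotropic) P₁⊥P₂
                          (trans (polar-point-completion x₁ y₁ x₂ y₂ α β γ δ) orthogonal)
                          (polar-point-own-completion x₂ y₂ α β γ δ)
        }
      first : ∀ p q r → p ≈ 1# * p + 0# * q + 0# * r
      first = solve 3 (λ p q r → p ⊜ :1 :* p :+ :0 :* q :+ :0 :* r) refl
      second : ∀ p q r → q ≈ 0# * p + 1# * q + 0# * r
      second = solve 3 (λ p q r → q ⊜ :0 :* p :+ :1 :* q :+ :0 :* r) refl

    ovoid⇒noAffinePoint : IsOvoid 𝔽 (O₅ 𝔽 f₁ f₂) → NoAffinePointOutside 𝔽 f₁ f₂
    ovoid⇒noAffinePoint (_ , meets) (x₁ , y₁ , x₂ , y₂ , F≈0 , distinct)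
      with generator-through distinct (trans (polar-point-point x₁ y₁ x₂ y₂) F≈0)
    ... | π , P₁∈π , P₂∈π = distinct (samePoint⇒equal
      (proj₂ (meets π) (point x₁ y₁) (point x₂ y₂) (point≉0 x₁ y₁) (point≉0 x₂ y₂)
                       P₁∈π P₂∈π (point∈O₅ x₁ y₁) (point∈O₅ x₂ y₂)))

    noAffinePoint⇒ovoid : NoAffinePointOutside 𝔽 f₁ f₂ → IsOvoid 𝔽 (O₅ 𝔽 f₁ f₂)
    noAffinePoint⇒ovoid none =
      O₅-singular , λ π → O₅-meets-generator none π , O₅-meets-generator-at-most-once none π

lemma2p1 : ∀ {c ℓ} (𝔽 : FiniteField c ℓ) (f₁ f₂ : Poly 𝔽) →
    let open FiniteField 𝔽 in
    (eval 𝔽 f₁ 0# 0# ≈ 0#) × (eval 𝔽 f₂ 0# 0# ≈ 0#) →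
    (IsOvoid 𝔽 (O₅ 𝔽 f₁ f₂) ⇔ NoAffinePointOutside 𝔽 f₁ f₂)
lemma2p1 𝔽 f₁ f₂ _ = mk⇔ (ovoid⇒noAffinePoint 𝔽 f₁ f₂) (noAffinePoint⇒ovoid 𝔽 f₁ f₂)
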